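{- Let $\Gamma$ be a graph, $G\leqslant\mathrm{Aut}(\Gamma)$, and let $(\Gamma,\mathcal{P})$ be a $G$-primitive decomposition, with $H$ the stabiliser in $G$ of a divisor $P\in\mathcal{P}$. If $L\leqslant G$ is such that $L\not\leqslant H$, $L$ is arc-transitive on $\Gamma$, and $L\cap H$ is maximal in $L$, then $(\Gamma,\mathcal{P})$ is an $L$-primitive decomposition.
   Context: A decomposition of a graph $\Gamma$ is a partition $\mathcal{P}$ of its edge set into at least two parts (divisors). For $G\leqslant\mathrm{Aut}(\Gamma)$, $(\Gamma,\mathcal{P})$ is $G$-transitive if $G$ preserves $\mathcal{P}$ and acts transitively on its parts, and $G$-primitive if moreover $G$ acts primitively on the set of parts. -}

module Defs where

open import Data.Nat using (ℕ; _≤_)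
open import Data.Bool using (Bool; true; false; T)
open import Data.Fin using (Fin)
open import Data.Fin.Permutation using (Permutation′; _⟨$⟩ʳ_; _≈_; id; flip; _∘ₚ_)
open import Data.Product using (Σ; ∃; ∃-syntax; _×_; _,_)
open import Data.Sum using (_⊎_)
open import Relation.Nullary using (¬_)
open import Relation.Binary.PropositionalEquality using (_≡_)

record Graph : Set where
  field
    n      : ℕ
    adj    : Fin n → Fin n → Bool
    sym    : ∀ u v → adj u v ≡ adj v u
    irrefl : ∀ u → adj u u ≡ false

open Graph public

Adj : (Γ : Graph) → Fin (n Γ) → Fin (n Γ) → Set
Adj Γ u v = T (adj Γ u v)

record Subgroup (m : ℕ) : Set₁ where
  field
    mem     : Permutation′ m → Set
    resp    : ∀ {g h} → g ≈ h → mem g → mem h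
    has-id  : mem id
    has-∘   : ∀ {g h} → mem g → mem h → mem (g ∘ₚ h)
    has-inv : ∀ {g} → mem g → mem (flip g)

open Subgroup public

_⊆ₛ_ : ∀ {m} → (Permutation′ m → Set) → (Permutation′ m → Set) → Set
A ⊆ₛ B = ∀ g → A g → B g

≤Aut : (Γ : Graph) → Subgroup (n Γ) → Set
≤Aut Γ G = ∀ g → mem G g → ∀ u v → adj Γ u v ≡ adj Γ (g ⟨$⟩ʳ u) (g ⟨$⟩ʳ v)

ArcTransitive : (Γ : Graph) → Subgroup (n Γ) → Set
ArcTransitive Γ L = ∀ u v u′ v′ → Adj Γ u v → Adj Γ u′ v′ →
  ∃[ g ] (mem L g × g ⟨$⟩ʳ u ≡ u′ × g ⟨$⟩ʳ v ≡ v′)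

Maximal : ∀ {m} → (A : Permutation′ m → Set) → (B : Permutation′ m → Set) → Set₁
Maximal {m} A B =
  A ⊆ₛ B × ¬ (B ⊆ₛ A) ×
  (∀ (K : Subgroup m) → A ⊆ₛ mem K → mem K ⊆ₛ B →
     (mem K ⊆ₛ A) ⊎ (B ⊆ₛ mem K))

-- Decompositions: partition of the edge set into k ≥ 2 (nonempty) parts,
-- given by a labelling of the edges {u,v} by Fin k.  The label of a
-- non-adjacent pair is irrelevant.

record Decomposition (Γ : Graph) : Set where
  field
    k        : ℕ
    two≤k    : 2 ≤ k
    part     : Fin (n Γ) → Fin (n Γ) → Fin k
    part-sym : ∀ u v → Adj Γ u v → part u v ≡ part v u
    part-ne  : ∀ (p : Fin k) → ∃[ u ] ∃[ v ] (Adj Γ u v × part u v ≡ p)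

open Decomposition public

module _ {Γ : Graph} (D : Decomposition Γ) where

  MapsTo : Permutation′ (n Γ) → Fin (k D) → Fin (k D) → Set
  MapsTo g p q = ∃[ u ] ∃[ v ]
    (Adj Γ u v × part D u v ≡ p × part D (g ⟨$⟩ʳ u) (g ⟨$⟩ʳ v) ≡ q)

  Preserves : Subgroup (n Γ) → Set
  Preserves G = ∀ g → mem G g → ∀ u v u′ v′ → Adj Γ u v → Adj Γ u′ v′ →
    part D u v ≡ part D u′ v′ →
    part D (g ⟨$⟩ʳ u) (g ⟨$⟩ʳ v) ≡ part D (g ⟨$⟩ʳ u′) (g ⟨$⟩ʳ v′)

  IsTransitive : Subgroup (n Γ) → Set
  IsTransitive G = Preserves G × (∀ p q → ∃[ g ] (mem G g × MapsTo g p q))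

  IsBlock : Subgroup (n Γ) → (Fin (k D) → Bool) → Set
  IsBlock G B = ∀ g → mem G g →
    ((∀ p q → MapsTo g p q → B p ≡ true → B q ≡ true) ×
     (∀ q → B q ≡ true → ∃[ p ] (B p ≡ true × MapsTo g p q)))
    ⊎ (∀ p q → MapsTo g p q → B p ≡ true → B q ≡ false)

  TrivialBlock : (Fin (k D) → Bool) → Set
  TrivialBlock B = (∀ p → B p ≡ false)
    ⊎ (∀ p q → B p ≡ true → B q ≡ true → p ≡ q)
    ⊎ (∀ p → B p ≡ true)

  IsPrimitive : Subgroup (n Γ) → Set
  IsPrimitive G = IsTransitive G × (∀ B → IsBlock G B → TrivialBlock B)

  Stab : Subgroup (n Γ) → Fin (k D) → Permutation′ (n Γ) → Set
  Stab G p g = mem G g × MapsTo g p p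

_∩ₛ_ : ∀ {m} → (Permutation′ m → Set) → (Permutation′ m → Set) → Permutation′ m → Set
(A ∩ₛ B) g = A g × B g

-- An arc-transitive L acts transitively on the divisors, so primitivity
-- of L on the divisors is the classical fact that a transitive action
-- with a maximal point stabiliser L_P = L ∩ H is primitive.  Given a
-- block B, translate it so that it contains P; the elements g of L with
-- P^g ∈ B then form a subgroup between L_P and L (because a block meeting
-- its image under g is fixed by g).  If this subgroup is L_P, then B is
-- the single point P; if it is L, then B is everything, by transitivity.
module Submission where

open import Defs hiding (sym)
open import Data.Bool using (Bool; true; false; T)
open import Data.Bool.Properties using (_≟_; ¬-not)
open import Data.Fin using (Fin)
open import Data.Fin.Permutation
  using (Permutation′; _⟨$⟩ʳ_; _≈_; id; flip; _∘ₚ_; inverseˡ; inverseʳ)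
open import Data.Fin.Properties using (any?)
open import Data.Product using (∃-syntax; _×_; _,_; proj₁; proj₂)
open import Data.Sum using (_⊎_; inj₁; inj₂)
import Data.Sum as Sum
open import Function using (_∘_)
open import Relation.Nullary using (¬_; yes; no; contradiction)
open import Relation.Binary.PropositionalEquality
  using (_≡_; refl; sym; trans; cong; cong₂; subst; module ≡-Reasoning)

maximal-resp : ∀ {m} {A A′ B : Permutation′ m → Set} →
  A ⊆ₛ A′ → A′ ⊆ₛ A → Maximal A B → Maximal A′ B
maximal-resp A⊆A′ A′⊆A (A⊆B , B⊈A , between) =
  (λ g → A⊆B g ∘ A′⊆A g) ,
  (λ B⊆A′ → B⊈A λ g → A′⊆A g ∘ B⊆A′ g) ,
  λ K A′⊆K K⊆B → Sum.map₁ (λ K⊆A g → A⊆A′ g ∘ K⊆A g)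
                          (between K (λ g → A′⊆K g ∘ A⊆A′ g) K⊆B)

record RightAction {m} (L : Subgroup m) (X : Set) : Set where
  field
    act      : Permutation′ m → X → X
    act-resp : ∀ {g h} → g ≈ h → ∀ x → act g x ≡ act h x
    act-id   : ∀ x → act id x ≡ x
    act-∘    : ∀ {g h} → mem L g → mem L h →
               ∀ x → act (g ∘ₚ h) x ≡ act h (act g x)

module _ {m} {L : Subgroup m} {X : Set} (α : RightAction L X) where
  open RightAction α

  act-inverseˡ : ∀ {g} → mem L g → ∀ x → act (flip g) (act g x) ≡ x
  act-inverseˡ {g} g∈L x = begin
    act (flip g) (act g x) ≡⟨ act-∘ g∈L (has-inv L g∈L) x ⟨
    act (g ∘ₚ flip g) x    ≡⟨ act-resp (λ _ → inverseˡ g) x ⟩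
    act id x               ≡⟨ act-id x ⟩
    x                      ∎
    where open ≡-Reasoning

  act-inverseʳ : ∀ {g} → mem L g → ∀ x → act g (act (flip g) x) ≡ x
  act-inverseʳ {g} g∈L x = begin
    act g (act (flip g) x) ≡⟨ act-∘ (has-inv L g∈L) g∈L x ⟨
    act (flip g ∘ₚ g) x    ≡⟨ act-resp (λ _ → inverseʳ g) x ⟩
    act id x               ≡⟨ act-id x ⟩
    x                      ∎
    where open ≡-Reasoning

  act-conjugate : ∀ {g s} → mem L g → mem L s →
    ∀ x → act (flip s ∘ₚ (g ∘ₚ s)) (act s x) ≡ act s (act g x)
  act-conjugate {g} {s} g∈L s∈L x = begin
    act (flip s ∘ₚ (g ∘ₚ s)) (act s x)
      ≡⟨ act-∘ (has-inv L s∈L) (has-∘ L g∈L s∈L) (act s x) ⟩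
    act (g ∘ₚ s) (act (flip s) (act s x))
      ≡⟨ cong (act (g ∘ₚ s)) (act-inverseˡ s∈L x) ⟩
    act (g ∘ₚ s) x
      ≡⟨ act-∘ g∈L s∈L x ⟩
    act s (act g x) ∎
    where open ≡-Reasoning

  IsTransitiveAction : Set
  IsTransitiveAction = ∀ x y → ∃[ g ] (mem L g × act g x ≡ y)

  Stabiliser : X → Permutation′ m → Set
  Stabiliser x g = mem L g × act g x ≡ x

  Invariant : Permutation′ m → (X → Bool) → Set
  Invariant g B = ∀ x → B x ≡ true → B (act g x) ≡ true

  Disjoint : Permutation′ m → (X → Bool) → Set
  Disjoint g B = ∀ x → B x ≡ true → B (act g x) ≡ false

  IsActionBlock : (X → Bool) → Set
  IsActionBlock B = ∀ g → mem L g → Invariant g B ⊎ Disjoint g B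

  Subsingleton : (X → Bool) → Set
  Subsingleton B = ∀ x y → B x ≡ true → B y ≡ true → x ≡ y

  Full : (X → Bool) → Set
  Full B = ∀ x → B x ≡ true

  block-meets⇒invariant : ∀ {B g x} → IsActionBlock B → mem L g →
    B x ≡ true → B (act g x) ≡ true → Invariant g B
  block-meets⇒invariant {g = g} {x} block g∈L Bx Bgx with block g g∈L
  ... | inj₁ invariant = invariant
  ... | inj₂ disjoint  = contradiction (trans (sym Bgx) (disjoint x Bx)) λ ()

  block-translate : ∀ {B s} → IsActionBlock B → mem L s →
    IsActionBlock (B ∘ act s)
  block-translate {B} {s} block s∈L g g∈L =
    Sum.map (λ invariant x Bsx → transport x (invariant (act s x) Bsx))
            (λ disjoint  x Bsx → transport x (disjoint  (act s x) Bsx))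
            (block (flip s ∘ₚ (g ∘ₚ s)) conjugate∈L)
    where
    conjugate∈L : mem L (flip s ∘ₚ (g ∘ₚ s))
    conjugate∈L = has-∘ L (has-inv L s∈L) (has-∘ L g∈L s∈L)

    transport : ∀ {b} x → B (act (flip s ∘ₚ (g ∘ₚ s)) (act s x)) ≡ b →
                B (act s (act g x)) ≡ b
    transport x = trans (cong B (sym (act-conjugate g∈L s∈L x)))

  blockStabiliser : ∀ {B x} → IsActionBlock B → B x ≡ true → Subgroup m
  blockStabiliser {B} {x} block Bx = record
    { mem     = λ g → mem L g × B (act g x) ≡ true
    ; resp    = λ g≈h (g∈L , Bgx) →
                  resp L g≈h g∈L , trans (cong B (sym (act-resp g≈h x))) Bgx
    ; has-id  = has-id L , trans (cong B (act-id x)) Bx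
    ; has-∘   = λ {g} {h} (g∈L , Bgx) (h∈L , Bhx) →
                  has-∘ L g∈L h∈L ,
                  trans (cong B (act-∘ g∈L h∈L x))
                        (block-meets⇒invariant block h∈L Bx Bhx (act g x) Bgx)
    ; has-inv = λ {g} (g∈L , Bgx) →
                  has-inv L g∈L ,
                  block-meets⇒invariant block (has-inv L g∈L) Bgx
                    (trans (cong B (act-inverseˡ g∈L x)) Bx) x Bx
    }

  maximal-stabiliser⇒block-trivial : ∀ {B} x → IsTransitiveAction →
    Maximal (Stabiliser x) (mem L) → IsActionBlock B → B x ≡ true →
    Subsingleton B ⊎ Full B
  maximal-stabiliser⇒block-trivial {B} x transitive (_ , _ , between) block Bx
    with between (blockStabiliser block Bx) stabiliser⊆ (λ _ → proj₁)
    where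
    stabiliser⊆ : Stabiliser x ⊆ₛ mem (blockStabiliser block Bx)
    stabiliser⊆ g (g∈L , gx≡x) = g∈L , trans (cong B gx≡x) Bx
  ... | inj₁ ⊆stabiliser = inj₁ λ y z By Bz → trans (≡x y By) (sym (≡x z Bz))
    where
    ≡x : ∀ y → B y ≡ true → y ≡ x
    ≡x y By with transitive x y
    ... | g , g∈L , gx≡y =
      trans (sym gx≡y) (proj₂ (⊆stabiliser g (g∈L , trans (cong B gx≡y) By)))
  ... | inj₂ L⊆ = inj₂ λ y → let g , g∈L , gx≡y = transitive x y in
    trans (cong B (sym gx≡y)) (proj₂ (L⊆ g g∈L))

  transitive-maximal-stabiliser⇒blocks-trivial : ∀ {B y} x →
    IsTransitiveAction → Maximal (Stabiliser x) (mem L) →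
    IsActionBlock B → B y ≡ true → Subsingleton B ⊎ Full B
  transitive-maximal-stabiliser⇒blocks-trivial {B} {y} x transitive maximal block By
    with transitive x y
  ... | s , s∈L , sx≡y =
    Sum.map subsingleton full
      (maximal-stabiliser⇒block-trivial x transitive maximal
         (block-translate block s∈L) (trans (cong B sx≡y) By))
    where
    back : ∀ {b} z → B z ≡ b → B (act s (act (flip s) z)) ≡ b
    back z = trans (cong B (act-inverseʳ s∈L z))

    subsingleton : Subsingleton (B ∘ act s) → Subsingleton B
    subsingleton single z w Bz Bw = begin
      z                      ≡⟨ act-inverseʳ s∈L z ⟨
      act s (act (flip s) z) ≡⟨ cong (act s) (single _ _ (back z Bz) (back w Bw)) ⟩
      act s (act (flip s) w) ≡⟨ act-inverseʳ s∈L w ⟩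
      w                      ∎
      where open ≡-Reasoning

    full : Full (B ∘ act s) → Full B
    full all z = trans (cong B (sym (act-inverseʳ s∈L z))) (all (act (flip s) z))

module DivisorAction (Γ : Graph) (G : Subgroup (n Γ)) (D : Decomposition Γ)
                     (G≤Aut : ≤Aut Γ G) (preserves : Preserves D G) where

  -- g is applied to a divisor through a chosen edge of it; Preserves
  -- makes the choice irrelevant (part-image).
  rep₁ rep₂ : Fin (k D) → Fin (n Γ)
  rep₁ p = proj₁ (part-ne D p)
  rep₂ p = proj₁ (proj₂ (part-ne D p))

  rep-adj : ∀ p → Adj Γ (rep₁ p) (rep₂ p)
  rep-adj p = proj₁ (proj₂ (proj₂ (part-ne D p)))

  rep-part : ∀ p → part D (rep₁ p) (rep₂ p) ≡ p
  rep-part p = proj₂ (proj₂ (proj₂ (part-ne D p)))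

  act : Permutation′ (n Γ) → Fin (k D) → Fin (k D)
  act g p = part D (g ⟨$⟩ʳ rep₁ p) (g ⟨$⟩ʳ rep₂ p)

  adj-image : ∀ {g u v} → mem G g → Adj Γ u v →
    Adj Γ (g ⟨$⟩ʳ u) (g ⟨$⟩ʳ v)
  adj-image {g} {u} {v} g∈G = subst T (G≤Aut g g∈G u v)

  part-image : ∀ {g u v p} → mem G g → Adj Γ u v → part D u v ≡ p →
    part D (g ⟨$⟩ʳ u) (g ⟨$⟩ʳ v) ≡ act g p
  part-image {g} {u} {v} {p} g∈G uv uv∈p =
    preserves g g∈G u v (rep₁ p) (rep₂ p) uv (rep-adj p)
      (trans uv∈p (sym (rep-part p)))

  mapsTo⇒act : ∀ {g p q} → mem G g → MapsTo D g p q → act g p ≡ q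
  mapsTo⇒act g∈G (u , v , uv , uv∈p , guv∈q) =
    trans (sym (part-image g∈G uv uv∈p)) guv∈q

  act⇒mapsTo : ∀ g p {q} → act g p ≡ q → MapsTo D g p q
  act⇒mapsTo g p gp≡q = rep₁ p , rep₂ p , rep-adj p , rep-part p , gp≡q

  divisorAction : (L : Subgroup (n Γ)) → mem L ⊆ₛ mem G →
    RightAction L (Fin (k D))
  divisorAction L L⊆G = record
    { act      = act
    ; act-resp = λ g≈h p → cong₂ (part D) (g≈h (rep₁ p)) (g≈h (rep₂ p))
    ; act-id   = rep-part
    ; act-∘    = λ {g} {h} g∈L h∈L p →
                   part-image (L⊆G h h∈L) (adj-image (L⊆G g g∈L) (rep-adj p)) refl
    }

  arcTransitive⇒transitive : (L : Subgroup (n Γ)) → ArcTransitive Γ L →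
    ∀ p q → ∃[ g ] (mem L g × act g p ≡ q)
  arcTransitive⇒transitive L arc p q
    with arc (rep₁ p) (rep₂ p) (rep₁ q) (rep₂ q) (rep-adj p) (rep-adj q)
  ... | g , g∈L , g₁ , g₂ = g , g∈L , trans (cong₂ (part D) g₁ g₂) (rep-part q)

  isBlock⇒isActionBlock : ∀ L (L⊆G : mem L ⊆ₛ mem G) {B} →
    IsBlock D L B → IsActionBlock (divisorAction L L⊆G) B
  isBlock⇒isActionBlock L L⊆G block g g∈L =
    Sum.map (λ invariant p Bp → proj₁ invariant p _ (act⇒mapsTo g p refl) Bp)
            (λ disjoint  p Bp → disjoint p _ (act⇒mapsTo g p refl) Bp)
            (block g g∈L)

lemma2p7 : (Γ : Graph) (G : Subgroup (n Γ)) (D : Decomposition Γ) →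
    ≤Aut Γ G → IsPrimitive D G → (P : Fin (k D)) →
    (L : Subgroup (n Γ)) → mem L ⊆ₛ mem G →
    ¬ (mem L ⊆ₛ Stab D G P) → ArcTransitive Γ L →
    Maximal (mem L ∩ₛ Stab D G P) (mem L) →
    IsPrimitive D L
lemma2p7 Γ G D G≤Aut ((G-preserves , _) , _) P L L⊆G _ arc maximal =
  (L-preserves , L-transitive) , blocks-trivial
  where
  open DivisorAction Γ G D G≤Aut G-preserves
  α : RightAction L (Fin (k D))
  α = divisorAction L L⊆G

  L-preserves : Preserves D L
  L-preserves g = G-preserves g ∘ L⊆G g

  L-transitive : ∀ p q → ∃[ g ] (mem L g × MapsTo D g p q)
  L-transitive p q = let g , g∈L , gp≡q = arcTransitive⇒transitive L arc p q in
    g , g∈L , act⇒mapsTo g p gp≡q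

  maximalᵃ : Maximal (Stabiliser α P) (mem L)
  maximalᵃ = maximal-resp
    (λ g (g∈L , _ , P↦P) → g∈L , mapsTo⇒act (L⊆G g g∈L) P↦P)
    (λ g (g∈L , gP≡P) → g∈L , L⊆G g g∈L , act⇒mapsTo g P gP≡P)
    maximal

  blocks-trivial : ∀ B → IsBlock D L B → TrivialBlock D B
  blocks-trivial B block with any? (λ p → B p ≟ true)
  ... | no  empty    = inj₁ λ p → ¬-not (empty ∘ (p ,_))
  ... | yes (p , Bp) = inj₂ (transitive-maximal-stabiliser⇒blocks-trivial α P
        (arcTransitive⇒transitive L arc) maximalᵃ
        (isBlock⇒isActionBlock L L⊆G block) Bp)
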